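{- For partitions $\gamma$ and $\mu$ with $|\mu|<|\gamma|$, $\overline{\mathbf p}_\gamma[\Xi_\mu]=0$. Moreover, if $|\mu|=|\gamma|$, then $\overline{\mathbf p}_\gamma[\Xi_\mu]=z_\gamma\,\delta_{\gamma=\mu}$.
   Context: $Sym=\mathbb{Q}[p_1,p_2,\dots]$ with power sums $p_k$. For $i\ge1,r\ge0$ define $\overline{\mathbf p}_{i^r}=i^r\big(\frac1i\sum_{d\mid i}\mu_M(i/d)p_d\big)_r$ and $\overline{\mathbf p}_\gamma=\prod_{i\ge1}\overline{\mathbf p}_{i^{m_i(\gamma)}}$, where $(x)_r=x(x-1)\cdots(x-r+1)$, $\mu_M$ is the Möbius function, $m_i(\gamma)$ is the number of parts of $\gamma$ equal to $i$, and $z_\gamma=\prod_i i^{m_i(\gamma)}m_i(\gamma)!$. For $k\ge1$, $\Xi_k$ is the multiset of the $k$ $k$-th roots of unity, $\Xi_\mu$ is the multiset union of $\Xi_{\mu_1},\dots,\Xi_{\mu_{\ell(\mu)}}$, and $f[\Xi_\mu]$ means replacing each $p_k$ in $f$ by the sum of the $k$-th powers of the elements of $\Xi_\mu$. $\delta_{\gamma=\mu}$ is $1$ if $\gamma=\mu$ and $0$ otherwise. -}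

module Defs where

open import Data.Nat as ℕ using (ℕ; zero; suc; _≤_)
open import Data.Nat.Divisibility using (_∣_; _∣?_)
open import Data.Nat.DivMod using (_/_)
open import Data.Nat.Primality using (prime?)
open import Data.Integer as ℤ using (ℤ; +_)
open import Data.Rational as ℚ using (ℚ; 0ℚ; 1ℚ)
open import Data.List using (List; []; _∷_; length; filter; map; foldr; upTo)
open import Data.List.Relation.Unary.All using (All)
open import Data.List.Relation.Unary.Linked using (Linked)
open import Data.List.Properties using (≡-dec)
open import Data.Bool using (Bool; true; false; if_then_else_)
open import Data.Product using (_×_)
open import Relation.Nullary.Decidable using (_×-dec_)
open import Data.Nat.ListAction using (sum)
open import Relation.Nullary.Decidable using (does; ⌊_⌋)
open import Relation.Binary.PropositionalEquality using (_≡_)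

IsPartition : List ℕ → Set
IsPartition l = All (λ x → 1 ≤ x) l × Linked (λ a b → b ≤ a) l

size : List ℕ → ℕ
size = sum

mult : ℕ → List ℕ → ℕ
mult i γ = length (filter (λ x → x ℕ.≟ i) γ)

oneTo : ℕ → List ℕ
oneTo n = map suc (upTo n)

Σℚ : List ℚ → ℚ
Σℚ = foldr ℚ._+_ 0ℚ

Πℚ : List ℚ → ℚ
Πℚ = foldr ℚ._*_ 1ℚ

ℕ→ℚ : ℕ → ℚ
ℕ→ℚ n = (+ n) ℚ./ 1

-- Möbius function μ_M(n) for n ≥ 1 (μ_M(0) is irrelevant; set by the same formula):
-- 0 if d² ∣ n for some d ≥ 2, otherwise (-1)^(number of primes dividing n).
squareFree : ℕ → Bool
squareFree n = foldr (λ d b → if does ((suc (suc d) ℕ.* suc (suc d)) ∣? n) then false else b) true (upTo n)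

numPrimeDivisors : ℕ → ℕ
numPrimeDivisors n = length (filter (λ p → prime? p ×-dec (p ∣? n)) (oneTo n))

möbius : ℕ → ℤ
möbius n = if squareFree n then (ℤ.- (+ 1)) ℤ.^ numPrimeDivisors n else + 0

-- A specialization of Sym = ℚ[p₁,p₂,…]: the ring map is determined by the images of p_k (k ≥ 1).
Specialization : Set
Specialization = ℕ → ℚ

falling : ℚ → ℕ → ℚ
falling x zero = 1ℚ
falling x (suc r) = falling x r ℚ.* (x ℚ.- ℕ→ℚ r)

-- image of (1/i) Σ_{d ∣ i} μ_M(i/d) p_d, for i ≥ 1 (written i = suc k)
qbar : Specialization → ℕ → ℚ
qbar ρ k = ((+ 1) ℚ./ suc k) ℚ.*
  Σℚ (map (λ d → if ⌊ suc d ∣? suc k ⌋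
                    then (möbius (suc k / suc d) ℚ./ 1) ℚ.* ρ (suc d)
                    else 0ℚ)
          (upTo (suc k)))

-- image of p̄_{i^r} = i^r (q_i)_r, for i = suc k
pbarPow : Specialization → ℕ → ℕ → ℚ
pbarPow ρ k r = ℕ→ℚ (suc k ℕ.^ r) ℚ.* falling (qbar ρ k) r

-- image of p̄_γ = ∏_{i ≥ 1} p̄_{i^{m_i(γ)}}; factors with i > |γ| have m_i = 0 and equal 1.
pbar : List ℕ → Specialization → ℚ
pbar γ ρ = Πℚ (map (λ k → pbarPow ρ k (mult (suc k) γ)) (upTo (size γ)))

-- f[Ξ_μ]: p_k ↦ Σ_j Σ_{ζ ∈ Ξ_{μ_j}} ζ^k = Σ_j (μ_j if μ_j ∣ k else 0)
Ξ : List ℕ → Specialization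
Ξ μ k = Σℚ (map (λ m → if ⌊ m ∣? k ⌋ then ℕ→ℚ m else 0ℚ) μ)

z : List ℕ → ℚ
z γ = Πℚ (map (λ i → ℕ→ℚ (i ℕ.^ mult i γ ℕ.* (mult i γ) ℕ.!)) (oneTo (size γ)))

δ : List ℕ → List ℕ → ℚ
δ γ μ = if ⌊ ≡-dec ℕ._≟_ γ μ ⌋ then 1ℚ else 0ℚ

module Submission where

-- Under Ξ_μ the Möbius combination q_i = (1/i) Σ_{d ∣ i} μ_M(i/d) p_d becomes
-- (1/i) Σ_{m ∈ μ} m Σ_{d ∣ i, m ∣ d} μ_M(i/d), and since Σ_{e ∣ n} μ_M(e) = [n = 1] the inner
-- sum is [m = i]; so q_i[Ξ_μ] = m_i(μ) and p̄_γ[Ξ_μ] = Π_i i^{m_i(γ)} (m_i(μ))_{m_i(γ)}.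
-- A falling factorial (m)_r with m < r vanishes, so the product is 0 unless m_i(γ) ≤ m_i(μ)
-- for all i, i.e. unless γ is a sub-multiset of μ. That forces |γ| ≤ |μ|, with equality only
-- for γ = μ, and then the product is Π_i i^{m_i(γ)} m_i(γ)! = z_γ.

open import Defs
open import Data.List using (List; []; _∷_; map; filter; length; upTo)
open import Data.List.Membership.Propositional using (_∈_)
open import Data.List.Relation.Unary.Any using (Any; here; there)
open import Data.List.Relation.Unary.All using (All; []; _∷_)
open import Data.List.Relation.Unary.Unique.Propositional using (Unique)
open import Data.List.Relation.Binary.Permutation.Propositional using (_↭_)
open import Data.Product using (_×_; _,_; proj₁; proj₂; ∃)
open import Function using (_∘_; case_of_)
open import Function.Bundles using (_⇔_; mk⇔)
open import Level using (0ℓ)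
open import Relation.Binary.PropositionalEquality
  using (_≡_; _≢_; refl; sym; trans; cong; cong₂; subst; subst₂; module ≡-Reasoning)
open import Relation.Nullary using (¬_; Dec; yes; no; ¬?; contradiction)
open import Relation.Nullary.Decidable using (⌊_⌋)
open import Relation.Unary using (Pred; Decidable)
open ≡-Reasoning

module Lists where
  open import Data.List.Membership.Propositional.Properties using (∈-map⁺; ∈-map⁻)
  open import Data.List.Relation.Unary.AllPairs using ([]; _∷_)
  import Data.List.Relation.Unary.All as All
  open import Data.List.Relation.Binary.BagAndSetEquality using (∼bag⇒↭)
  open import Data.List.Membership.Propositional.Properties.WithK using (unique∧set⇒bag)

  private variable
    A B : Set

  unique-⇔⇒↭ : ∀ {xs ys : List A} → Unique xs → Unique ys → (∀ {x} → x ∈ xs ⇔ x ∈ ys) → xs ↭ ys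
  unique-⇔⇒↭ xs! ys! xs⇔ys = ∼bag⇒↭ (unique∧set⇒bag xs! ys! xs⇔ys)

  map⁺-injectiveOn : ∀ (f : A → B) {xs} → (∀ {x y} → x ∈ xs → y ∈ xs → f x ≡ f y → x ≡ y) →
                     Unique xs → Unique (map f xs)
  map⁺-injectiveOn f {[]}     inj []           = []
  map⁺-injectiveOn f {x ∷ xs} inj (x∉xs ∷ xs!) =
    All.tabulate fx∉ ∷ map⁺-injectiveOn f (λ x∈ y∈ → inj (there x∈) (there y∈)) xs!
    where
    fx∉ : ∀ {z} → z ∈ map f xs → f x ≢ z
    fx∉ z∈ fx≡z with ∈-map⁻ f z∈
    ... | y , y∈ , refl = All.lookup x∉xs y∈ (inj (here refl) (there y∈) fx≡z)

  map-involution-↭ : ∀ (f : A → A) {xs} → (∀ {x} → x ∈ xs → f x ∈ xs) → (∀ {x} → x ∈ xs → f (f x) ≡ x) →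
                     Unique xs → map f xs ↭ xs
  map-involution-↭ f {xs} closed involutive xs! =
    unique-⇔⇒↭ (map⁺-injectiveOn f injective xs!) xs! (mk⇔ image⇒ ⇒image)
    where
    injective : ∀ {x y} → x ∈ xs → y ∈ xs → f x ≡ f y → x ≡ y
    injective x∈ y∈ fx≡fy = trans (sym (involutive x∈)) (trans (cong f fx≡fy) (involutive y∈))
    image⇒ : ∀ {y} → y ∈ map f xs → y ∈ xs
    image⇒ y∈ with ∈-map⁻ f y∈
    ... | x , x∈ , refl = closed x∈
    ⇒image : ∀ {y} → y ∈ xs → y ∈ map f xs
    ⇒image y∈ = subst (_∈ map f xs) (involutive y∈) (∈-map⁺ f (closed y∈))

module Conditionals {A P : Set} (P? : Dec P) {x y : A} where
  open import Data.Bool using (if_then_else_)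
  open import Relation.Nullary.Decidable using (isYes≗does; dec-true; dec-false)

  if-yes : P → (if ⌊ P? ⌋ then x else y) ≡ x
  if-yes p = cong (if_then x else y) (trans (isYes≗does P?) (dec-true P? p))

  if-no : ¬ P → (if ⌊ P? ⌋ then x else y) ≡ y
  if-no ¬p = cong (if_then x else y) (trans (isYes≗does P?) (dec-false P? ¬p))

module RationalEmbedding where
  open import Data.Nat as ℕ using (ℕ; suc)
  import Data.Nat.Properties as ℕ
  open import Data.Integer as ℤ using (ℤ; +_)
  open import Data.Integer.Properties using (pos-*)
  open import Data.Integer.Solver using (module +-*-Solver)
  open import Data.Rational using (ℚ; 1ℚ; _+_; _*_; -_; _/_; fromℚᵘ)
  open import Data.Rational.Properties
    using (toℚᵘ-injective; toℚᵘ-fromℚᵘ; fromℚᵘ-cong; toℚᵘ-homo-+; toℚᵘ-homo-*; toℚᵘ-homo‿-)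
  open import Data.Rational.Unnormalised as ℚᵘ using (mkℚᵘ; *≡*)
  open import Data.Rational.Unnormalised.Properties as ℚᵘ using (≃-sym; ≃-trans)
  open +-*-Solver

  fromℚᵘ-homo-+ : ∀ p q → fromℚᵘ (p ℚᵘ.+ q) ≡ fromℚᵘ p + fromℚᵘ q
  fromℚᵘ-homo-+ p q = toℚᵘ-injective (≃-trans (toℚᵘ-fromℚᵘ (p ℚᵘ.+ q))
    (≃-sym (≃-trans (toℚᵘ-homo-+ (fromℚᵘ p) (fromℚᵘ q)) (ℚᵘ.+-cong (toℚᵘ-fromℚᵘ p) (toℚᵘ-fromℚᵘ q)))))

  fromℚᵘ-homo-* : ∀ p q → fromℚᵘ (p ℚᵘ.* q) ≡ fromℚᵘ p * fromℚᵘ q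
  fromℚᵘ-homo-* p q = toℚᵘ-injective (≃-trans (toℚᵘ-fromℚᵘ (p ℚᵘ.* q))
    (≃-sym (≃-trans (toℚᵘ-homo-* (fromℚᵘ p) (fromℚᵘ q)) (ℚᵘ.*-cong (toℚᵘ-fromℚᵘ p) (toℚᵘ-fromℚᵘ q)))))

  fromℚᵘ-homo‿- : ∀ p → fromℚᵘ (ℚᵘ.- p) ≡ - fromℚᵘ p
  fromℚᵘ-homo‿- p = toℚᵘ-injective (≃-trans (toℚᵘ-fromℚᵘ (ℚᵘ.- p))
    (≃-sym (≃-trans (toℚᵘ-homo‿- (fromℚᵘ p)) (ℚᵘ.-‿cong (toℚᵘ-fromℚᵘ p)))))

  ℤ→ℚ : ℤ → ℚ
  ℤ→ℚ i = i / 1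

  ℤ→ℚ-+ : ∀ i j → ℤ→ℚ (i ℤ.+ j) ≡ ℤ→ℚ i + ℤ→ℚ j
  ℤ→ℚ-+ i j = trans
    (fromℚᵘ-cong {mkℚᵘ (i ℤ.+ j) 0} {mkℚᵘ i 0 ℚᵘ.+ mkℚᵘ j 0}
      (*≡* (solve 2 (λ a b → (a :+ b) :* con (+ 1) := (a :* con (+ 1) :+ b :* con (+ 1)) :* con (+ 1)) refl i j)))
    (fromℚᵘ-homo-+ (mkℚᵘ i 0) (mkℚᵘ j 0))

  ℤ→ℚ-* : ∀ i j → ℤ→ℚ (i ℤ.* j) ≡ ℤ→ℚ i * ℤ→ℚ j
  ℤ→ℚ-* i j = fromℚᵘ-homo-* (mkℚᵘ i 0) (mkℚᵘ j 0)

  ℤ→ℚ-neg : ∀ i → ℤ→ℚ (ℤ.- i) ≡ - ℤ→ℚ i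
  ℤ→ℚ-neg i = fromℚᵘ-homo‿- (mkℚᵘ i 0)

  ℕ→ℚ-suc : ∀ n → ℕ→ℚ (suc n) ≡ 1ℚ + ℕ→ℚ n
  ℕ→ℚ-suc n = ℤ→ℚ-+ (+ 1) (+ n)

  ℕ→ℚ-* : ∀ m n → ℕ→ℚ (m ℕ.* n) ≡ ℕ→ℚ m * ℕ→ℚ n
  ℕ→ℚ-* m n = trans (cong ℤ→ℚ (pos-* m n)) (ℤ→ℚ-* (+ m) (+ n))

  1/n*n≡1 : ∀ n .{{_ : ℕ.NonZero n}} → (+ 1 / n) * ℕ→ℚ n ≡ 1ℚ
  1/n*n≡1 (suc k) = trans (sym (fromℚᵘ-homo-* (mkℚᵘ (+ 1) k) (mkℚᵘ (+ suc k) 0)))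
    (fromℚᵘ-cong {mkℚᵘ (+ 1) k ℚᵘ.* mkℚᵘ (+ suc k) 0} {mkℚᵘ (+ 1) 0}
      (*≡* (cong (λ x → + suc x) (trans (ℕ.*-identityʳ (k ℕ.+ 0)) (cong (ℕ._+ 0) (sym (ℕ.*-identityʳ k)))))))

module FiniteSums where
  open import Data.Rational using (ℚ; 0ℚ; 1ℚ; _+_; _*_; -_)
  open import Data.Rational.Properties
    using ( +-identityˡ; +-assoc; *-comm; *-identityˡ; *-zeroˡ; *-zeroʳ; *-distribˡ-+; *-distribʳ-+
          ; neg-distrib-+; +-0-commutativeMonoid)
  open import Data.List.Properties using (map-cong)
  open import Data.List.Relation.Binary.Permutation.Propositional using (↭⇒↭ₛ)
  open import Data.List.Relation.Binary.Permutation.Setoid.Properties using (foldr-commMonoid)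
  open import Algebra.Bundles using (CommutativeMonoid)
  open import Algebra.Properties.CommutativeSemigroup (CommutativeMonoid.commutativeSemigroup +-0-commutativeMonoid)
    using (x∙yz≈y∙xz; interchange)
  open import Data.Bool using (if_then_else_)
  open RationalEmbedding using (ℕ→ℚ-suc)

  private variable
    A B : Set

  Σℚ-zero : ∀ {f : A → ℚ} xs → (∀ {x} → x ∈ xs → f x ≡ 0ℚ) → Σℚ (map f xs) ≡ 0ℚ
  Σℚ-zero []       f≡0 = refl
  Σℚ-zero (x ∷ xs) f≡0 = cong₂ _+_ (f≡0 (here refl)) (Σℚ-zero xs (f≡0 ∘ there))

  Σℚ-const : ∀ {f : A → ℚ} {c} xs → All (λ x → f x ≡ c) xs → Σℚ (map f xs) ≡ ℕ→ℚ (length xs) * c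
  Σℚ-const {c = c} []       []         = sym (*-zeroˡ c)
  Σℚ-const {c = c} (x ∷ xs) (fx≡c ∷ h) = begin
    _                             ≡⟨ cong₂ _+_ (trans fx≡c (sym (*-identityˡ c))) (Σℚ-const xs h) ⟩
    1ℚ * c + ℕ→ℚ (length xs) * c  ≡⟨ *-distribʳ-+ c 1ℚ (ℕ→ℚ (length xs)) ⟨
    (1ℚ + ℕ→ℚ (length xs)) * c    ≡⟨ cong (_* c) (ℕ→ℚ-suc (length xs)) ⟨
    ℕ→ℚ (length (x ∷ xs)) * c     ∎

  Σℚ-if : ∀ {P : Pred A 0ℓ} (P? : Decidable P) (f : A → ℚ) xs →
          Σℚ (map (λ x → if ⌊ P? x ⌋ then f x else 0ℚ) xs) ≡ Σℚ (map f (filter P? xs))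
  Σℚ-if P? f []       = refl
  Σℚ-if P? f (x ∷ xs) with P? x
  ... | yes _ = cong (f x +_) (Σℚ-if P? f xs)
  ... | no  _ = trans (+-identityˡ _) (Σℚ-if P? f xs)

  Σℚ-partition : ∀ {P : Pred A 0ℓ} (P? : Decidable P) (f : A → ℚ) xs →
                 Σℚ (map f xs) ≡ Σℚ (map f (filter P? xs)) + Σℚ (map f (filter (¬? ∘ P?) xs))
  Σℚ-partition P? f []       = refl
  Σℚ-partition P? f (x ∷ xs) with P? x
  ... | yes _ = trans (cong (f x +_) (Σℚ-partition P? f xs)) (sym (+-assoc (f x) S⁺ S⁻))
    where
    S⁺ = Σℚ (map f (filter P? xs))
    S⁻ = Σℚ (map f (filter (¬? ∘ P?) xs))
  ... | no  _ = trans (cong (f x +_) (Σℚ-partition P? f xs)) (x∙yz≈y∙xz (f x) S⁺ S⁻)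
    where
    S⁺ = Σℚ (map f (filter P? xs))
    S⁻ = Σℚ (map f (filter (¬? ∘ P?) xs))

  Σℚ-*ˡ : ∀ c (f : A → ℚ) xs → c * Σℚ (map f xs) ≡ Σℚ (map (λ x → c * f x) xs)
  Σℚ-*ˡ c f []       = *-zeroʳ c
  Σℚ-*ˡ c f (x ∷ xs) = trans (*-distribˡ-+ c (f x) _) (cong (c * f x +_) (Σℚ-*ˡ c f xs))

  Σℚ-*ʳ : ∀ c (f : A → ℚ) xs → Σℚ (map f xs) * c ≡ Σℚ (map (λ x → f x * c) xs)
  Σℚ-*ʳ c f xs = trans (*-comm _ c) (trans (Σℚ-*ˡ c f xs) (cong Σℚ (map-cong (λ x → *-comm c (f x)) xs)))

  Σℚ-neg : ∀ (f : A → ℚ) xs → - Σℚ (map f xs) ≡ Σℚ (map (λ x → - f x) xs)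
  Σℚ-neg f []       = refl
  Σℚ-neg f (x ∷ xs) = trans (neg-distrib-+ (f x) _) (cong (- f x +_) (Σℚ-neg f xs))

  Σℚ-+ : ∀ (f g : A → ℚ) xs → Σℚ (map (λ x → f x + g x) xs) ≡ Σℚ (map f xs) + Σℚ (map g xs)
  Σℚ-+ f g []       = refl
  Σℚ-+ f g (x ∷ xs) = trans (cong (f x + g x +_) (Σℚ-+ f g xs)) (interchange (f x) (g x) _ _)

  Σℚ-swap : ∀ (F : A → B → ℚ) xs ys →
            Σℚ (map (λ x → Σℚ (map (F x) ys)) xs) ≡ Σℚ (map (λ y → Σℚ (map (λ x → F x y) xs)) ys)
  Σℚ-swap F []       ys = sym (Σℚ-zero {f = λ _ → 0ℚ} ys (λ _ → refl))
  Σℚ-swap F (x ∷ xs) ys = trans (cong (Σℚ (map (F x) ys) +_) (Σℚ-swap F xs ys)) (sym (Σℚ-+ (F x) _ ys))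

  Σℚ-↭ : ∀ {xs ys} → xs ↭ ys → Σℚ xs ≡ Σℚ ys
  Σℚ-↭ = foldr-commMonoid setoid isCommutativeMonoid ∘ ↭⇒↭ₛ
    where open CommutativeMonoid +-0-commutativeMonoid using (setoid; isCommutativeMonoid)

  Πℚ-zero : ∀ (f : A → ℚ) xs → Any (λ x → f x ≡ 0ℚ) xs → Πℚ (map f xs) ≡ 0ℚ
  Πℚ-zero f (x ∷ xs) (here fx≡0) = trans (cong (_* Πℚ (map f xs)) fx≡0) (*-zeroˡ (Πℚ (map f xs)))
  Πℚ-zero f (x ∷ xs) (there any) = trans (cong (f x *_) (Πℚ-zero f xs any)) (*-zeroʳ (f x))

module Divisors where
  open import Data.Nat using (ℕ; zero; suc; _*_; _≤_; NonZero; ≢-nonZero⁻¹)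
  import Data.Nat.Properties as ℕ
  open import Data.Nat.Divisibility
  open import Data.Nat.DivMod using (_/_; m*n/n≡m; m*n/m*o≡n/o)
  open import Data.Nat.Primality using (Prime; prime⇒nonZero; prime⇒irreducible)
  open import Data.Nat.Coprimality using (Coprime; coprime-divisor)
  open import Data.List.Membership.Propositional.Properties using (∈-map⁺; ∈-map⁻; ∈-filter⁺; ∈-filter⁻; ∈-upTo⁺)
  import Data.List.Relation.Unary.Unique.Propositional.Properties as Unique
  open import Data.Sum using (inj₁; inj₂)
  open Lists

  divisors : ℕ → List ℕ
  divisors n = filter (_∣? n) (oneTo n)

  -- n ÷ d is n / d for d ≠ 0; the junk value at d = 0 never occurs on a list of divisors.
  _÷_ : ℕ → ℕ → ℕ
  n ÷ zero  = 0
  n ÷ suc d = n / suc d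

  ∣⇒nonZero : ∀ {d n} .{{_ : NonZero n}} → d ∣ n → NonZero d
  ∣⇒nonZero {zero}  {n} 0∣n = contradiction (0∣⇒≡0 0∣n) (≢-nonZero⁻¹ n)
  ∣⇒nonZero {suc d}     _   = _

  ∈-oneTo⁺ : ∀ {x n} .{{_ : NonZero x}} → x ≤ n → x ∈ oneTo n
  ∈-oneTo⁺ {suc x} x≤n = ∈-map⁺ suc (∈-upTo⁺ x≤n)

  oneTo-unique : ∀ n → Unique (oneTo n)
  oneTo-unique n = Unique.map⁺ ℕ.suc-injective (Unique.upTo⁺ n)

  ∈-filter-oneTo⁺ : ∀ {P : Pred ℕ 0ℓ} (P? : Decidable P) {x n} .{{_ : NonZero n}} →
                    x ∣ n → P x → x ∈ filter P? (oneTo n)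
  ∈-filter-oneTo⁺ P? x∣n = ∈-filter⁺ P? (∈-oneTo⁺ {{∣⇒nonZero x∣n}} (∣⇒≤ x∣n))

  ∈-divisors⁺ : ∀ {d n} .{{_ : NonZero n}} → d ∣ n → d ∈ divisors n
  ∈-divisors⁺ d∣n = ∈-filter-oneTo⁺ (_∣? _) d∣n d∣n

  ∈-divisors⁻ : ∀ {d n} → d ∈ divisors n → d ∣ n
  ∈-divisors⁻ {n = n} d∈ = proj₂ (∈-filter⁻ (_∣? n) {xs = oneTo n} d∈)

  divisors-unique : ∀ n → Unique (divisors n)
  divisors-unique n = Unique.filter⁺ (_∣? n) (oneTo-unique n)

  ∣-divisors-* : ∀ m n .{{_ : NonZero m}} .{{_ : NonZero n}} →
                 filter (m ∣?_) (divisors (m * n)) ↭ map (m *_) (divisors n)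
  ∣-divisors-* m n = unique-⇔⇒↭ (Unique.filter⁺ (m ∣?_) (divisors-unique (m * n)))
    (Unique.map⁺ (ℕ.*-cancelˡ-≡ _ _ m) (divisors-unique n)) (mk⇔ multiple⇒ ⇒multiple)
    where
    instance _ = ℕ.m*n≢0 m n
    multiple⇒ : ∀ {d} → d ∈ filter (m ∣?_) (divisors (m * n)) → d ∈ map (m *_) (divisors n)
    multiple⇒ d∈ with ∈-filter⁻ (m ∣?_) {xs = divisors (m * n)} d∈
    ... | qm∈ , divides q refl = subst (_∈ map (m *_) (divisors n)) (ℕ.*-comm m q)
      (∈-map⁺ (m *_) (∈-divisors⁺ (*-cancelˡ-∣ m (subst (_∣ m * n) (ℕ.*-comm q m) (∈-divisors⁻ qm∈)))))
    ⇒multiple : ∀ {d} → d ∈ map (m *_) (divisors n) → d ∈ filter (m ∣?_) (divisors (m * n))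
    ⇒multiple d∈ with ∈-map⁻ (m *_) d∈
    ... | e , e∈ , refl = ∈-filter⁺ (m ∣?_) (∈-divisors⁺ (*-monoʳ-∣ m (∈-divisors⁻ e∈))) (m∣m*n e)

  prime-∤⇒coprime : ∀ {p d} → Prime p → ¬ p ∣ d → Coprime d p
  prime-∤⇒coprime p-prime p∤d (c∣d , c∣p) with prime⇒irreducible p-prime c∣p
  ... | inj₁ c≡1  = c≡1
  ... | inj₂ refl = contradiction c∣d p∤d

  ∤-divisors-* : ∀ {p} → Prime p → ∀ n .{{_ : NonZero n}} →
                 filter (¬? ∘ (p ∣?_)) (divisors (p * n)) ↭ filter (¬? ∘ (p ∣?_)) (divisors n)
  ∤-divisors-* {p} p-prime n = unique-⇔⇒↭ (Unique.filter⁺ p∤? (divisors-unique (p * n)))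
    (Unique.filter⁺ p∤? (divisors-unique n)) (mk⇔ ∣p*n⇒∣n ∣n⇒∣p*n)
    where
    instance _ = ℕ.m*n≢0 p n {{prime⇒nonZero p-prime}}
    p∤? = ¬? ∘ (p ∣?_)
    ∣p*n⇒∣n : ∀ {d} → d ∈ filter p∤? (divisors (p * n)) → d ∈ filter p∤? (divisors n)
    ∣p*n⇒∣n d∈ with ∈-filter⁻ p∤? {xs = divisors (p * n)} d∈
    ... | d∈′ , p∤d =
      ∈-filter⁺ p∤? (∈-divisors⁺ (coprime-divisor (prime-∤⇒coprime p-prime p∤d) (∈-divisors⁻ d∈′))) p∤d
    ∣n⇒∣p*n : ∀ {d} → d ∈ filter p∤? (divisors n) → d ∈ filter p∤? (divisors (p * n))
    ∣n⇒∣p*n d∈ with ∈-filter⁻ p∤? {xs = divisors n} d∈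
    ... | d∈′ , p∤d = ∈-filter⁺ p∤? (∈-divisors⁺ (∣n⇒∣m*n p (∈-divisors⁻ d∈′))) p∤d

  *-÷-* : ∀ m n e .{{_ : NonZero m}} .{{_ : NonZero e}} → (m * n) ÷ (m * e) ≡ n ÷ e
  *-÷-* (suc m) n (suc e) = m*n/m*o≡n/o (suc m) n (suc e)

  ÷-∣ : ∀ {d n} .{{_ : NonZero n}} → d ∣ n → n ÷ d ∣ n
  ÷-∣ {zero}  {n} 0∣n = contradiction (0∣⇒≡0 0∣n) (≢-nonZero⁻¹ n)
  ÷-∣ {suc d}     d∣n = m/n∣m d∣n

  ÷-involutive : ∀ {d n} .{{_ : NonZero n}} → d ∣ n → n ÷ (n ÷ d) ≡ d
  ÷-involutive {zero}  {n} 0∣n = contradiction (0∣⇒≡0 0∣n) (≢-nonZero⁻¹ n)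
  ÷-involutive {suc d} (divides-refl zero) = contradiction refl (≢-nonZero⁻¹ 0)
  ÷-involutive {suc d} (divides-refl (suc q)) = begin
    (suc q * suc d) ÷ ((suc q * suc d) / suc d) ≡⟨ cong ((suc q * suc d) ÷_) (m*n/n≡m (suc q) (suc d)) ⟩
    (suc q * suc d) / suc q                     ≡⟨ cong (_/ suc q) (ℕ.*-comm (suc q) (suc d)) ⟩
    (suc d * suc q) / suc q                     ≡⟨ m*n/n≡m (suc d) (suc q) ⟩
    suc d                                       ∎

  divisors-complement : ∀ n .{{_ : NonZero n}} → map (n ÷_) (divisors n) ↭ divisors n
  divisors-complement n = map-involution-↭ (n ÷_)
    (λ d∈ → ∈-divisors⁺ (÷-∣ (∈-divisors⁻ d∈)))
    (λ d∈ → ÷-involutive (∈-divisors⁻ d∈))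
    (divisors-unique n)

module MöbiusFunction where
  open import Data.Nat using (ℕ; suc; _*_; NonZero)
  import Data.Nat.Properties as ℕ
  open import Data.Nat.Divisibility
  open import Data.Nat.Coprimality using (coprime-divisor)
  open import Data.Nat.Primality using (Prime; prime?; prime⇒nonZero; prime⇒nonTrivial; prime⇒irreducible; euclidsLemma)
  open import Data.Nat.Primality.Factorisation using (factorise)
  open import Data.Nat.ListAction using (product)
  open import Data.Integer as ℤ using (+_)
  open import Data.Integer.Properties using (-1*i≡-i)
  open import Data.List using (foldr)
  open import Data.List.Membership.Propositional using (lose)
  open import Data.List.Membership.Propositional.Properties using (∈-upTo⁺; ∈-filter⁻)
  open import Data.List.Relation.Unary.Any using (satisfied)
  import Data.List.Relation.Unary.All as All
  open import Data.List.Relation.Unary.AllPairs using (_∷_)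
  import Data.List.Relation.Unary.Unique.Propositional.Properties as Unique
  open import Data.List.Relation.Binary.Permutation.Propositional.Properties using (↭-length)
  open import Data.Bool as Bool using (Bool; true; false; if_then_else_)
  open import Data.Bool.Properties using (¬-not)
  open import Data.Sum using (inj₁; inj₂)
  open import Relation.Nullary using (does)
  open import Relation.Nullary.Decidable using (_×-dec_)
  open Lists
  open Divisors

  private variable
    A : Set

  -- squareFree n is definitionally noneᵇ (λ d → (2 + d) * (2 + d) ∣? n) (upTo n).
  noneᵇ : ∀ {P : Pred A 0ℓ} → Decidable P → List A → Bool
  noneᵇ P? = foldr (λ x b → if does (P? x) then false else b) true

  noneᵇ≡false⁺ : ∀ {P : Pred A 0ℓ} (P? : Decidable P) {xs} → Any P xs → noneᵇ P? xs ≡ false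
  noneᵇ≡false⁺ P? {x ∷ xs} any with P? x | any
  ... | yes _  | _          = refl
  ... | no ¬Px | here Px    = contradiction Px ¬Px
  ... | no _   | there any′ = noneᵇ≡false⁺ P? any′

  noneᵇ≡false⁻ : ∀ {P : Pred A 0ℓ} (P? : Decidable P) xs → noneᵇ P? xs ≡ false → Any P xs
  noneᵇ≡false⁻ P? (x ∷ xs) eq with P? x
  ... | yes Px = here Px
  ... | no _   = there (noneᵇ≡false⁻ P? xs eq)

  prime-factor : ∀ n → ∃ λ p → Prime p × p ∣ suc (suc n)
  prime-factor n with factorise (suc (suc n))
  ... | record { factors = p ∷ ps ; isFactorisation = eq ; factorsPrime = p-prime All.∷ _ } =
    p , p-prime , subst (p ∣_) (sym eq) (m∣m*n (product ps))

  squareFree≡false⁺ : ∀ {p n} .{{_ : NonZero n}} → Prime p → p * p ∣ n → squareFree n ≡ false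
  squareFree≡false⁺ {0}                   p-prime _    with () ← prime⇒nonTrivial p-prime
  squareFree≡false⁺ {1}                   p-prime _    with () ← prime⇒nonTrivial p-prime
  squareFree≡false⁺ {p@(suc (suc d))} {n} _       pp∣n =
    noneᵇ≡false⁺ (λ d → suc (suc d) * suc (suc d) ∣? n)
      (lose (∈-upTo⁺ (ℕ.<-trans (ℕ.n<1+n d) (ℕ.≤-trans (ℕ.m≤m*n p p) (∣⇒≤ pp∣n)))) pp∣n)

  squareFree≡false⁻ : ∀ {n} → squareFree n ≡ false → ∃ λ p → Prime p × p * p ∣ n
  squareFree≡false⁻ {n} eq with satisfied (noneᵇ≡false⁻ (λ d → suc (suc d) * suc (suc d) ∣? n) (upTo n) eq)
  ... | d , dd∣n with prime-factor d
  ... | p , p-prime , p∣d = p , p-prime , ∣-trans (*-pres-∣ p∣d p∣d) dd∣n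

  q*q∣p*n⇒q*q∣n : ∀ {p n q} → Prime p → ¬ p ∣ n → Prime q → q * q ∣ p * n → q * q ∣ n
  q*q∣p*n⇒q*q∣n {p} {n} {q} p-prime p∤n q-prime qq∣pn with q ℕ.≟ p
  ... | yes refl = contradiction (*-cancelˡ-∣ p {{prime⇒nonZero p-prime}} qq∣pn) p∤n
  ... | no q≢p   = coprime-divisor (prime-∤⇒coprime p-prime p∤qq) qq∣pn
    where
    p∤q : ¬ p ∣ q
    p∤q p∣q with prime⇒irreducible q-prime p∣q
    ... | inj₁ refl with () ← prime⇒nonTrivial p-prime
    ... | inj₂ p≡q  = q≢p (sym p≡q)
    p∤qq : ¬ p ∣ q * q
    p∤qq p∣qq with euclidsLemma q q p-prime p∣qq
    ... | inj₁ p∣q = p∤q p∣q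
    ... | inj₂ p∣q = p∤q p∣q

  squareFree-*-prime : ∀ {p n} .{{_ : NonZero n}} → Prime p → ¬ p ∣ n →
                       squareFree n ≡ true → squareFree (p * n) ≡ true
  squareFree-*-prime p-prime p∤n sf = ¬-not λ p*n-not-squareFree →
    case squareFree≡false⁻ p*n-not-squareFree of λ where
      (q , q-prime , qq∣pn) →
        case trans (sym sf) (squareFree≡false⁺ q-prime (q*q∣p*n⇒q*q∣n p-prime p∤n q-prime qq∣pn)) of λ ()

  primeDivisors : ℕ → List ℕ
  primeDivisors n = filter (λ p → prime? p ×-dec (p ∣? n)) (oneTo n)

  ∈-primeDivisors⁺ : ∀ {p n} .{{_ : NonZero n}} → Prime p → p ∣ n → p ∈ primeDivisors n
  ∈-primeDivisors⁺ p-prime p∣n = ∈-filter-oneTo⁺ (λ p → prime? p ×-dec (p ∣? _)) p∣n (p-prime , p∣n)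

  ∈-primeDivisors⁻ : ∀ {p n} → p ∈ primeDivisors n → Prime p × p ∣ n
  ∈-primeDivisors⁻ {n = n} p∈ = proj₂ (∈-filter⁻ (λ p → prime? p ×-dec (p ∣? n)) {xs = oneTo n} p∈)

  primeDivisors-*-prime : ∀ {p n} .{{_ : NonZero n}} → Prime p → ¬ p ∣ n →
                          primeDivisors (p * n) ↭ p ∷ primeDivisors n
  primeDivisors-*-prime {p} {n} p-prime p∤n = unique-⇔⇒↭
    (Unique.filter⁺ _ (oneTo-unique (p * n)))
    (All.tabulate p∉ ∷ Unique.filter⁺ _ (oneTo-unique n))
    (mk⇔ ∣p*n⇒ ⇒∣p*n)
    where
    instance _ = ℕ.m*n≢0 p n {{prime⇒nonZero p-prime}}
    p∉ : ∀ {q} → q ∈ primeDivisors n → p ≢ q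
    p∉ q∈ refl = p∤n (proj₂ (∈-primeDivisors⁻ q∈))
    ∣p*n⇒ : ∀ {q} → q ∈ primeDivisors (p * n) → q ∈ p ∷ primeDivisors n
    ∣p*n⇒ q∈ with ∈-primeDivisors⁻ q∈
    ... | q-prime , q∣pn with euclidsLemma p n q-prime q∣pn
    ... | inj₂ q∣n = there (∈-primeDivisors⁺ q-prime q∣n)
    ... | inj₁ q∣p with prime⇒irreducible p-prime q∣p
    ...   | inj₁ refl with () ← prime⇒nonTrivial q-prime
    ...   | inj₂ refl = here refl
    ⇒∣p*n : ∀ {q} → q ∈ p ∷ primeDivisors n → q ∈ primeDivisors (p * n)
    ⇒∣p*n (here refl) = ∈-primeDivisors⁺ p-prime (m∣m*n n)
    ⇒∣p*n (there q∈) with ∈-primeDivisors⁻ q∈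
    ... | q-prime , q∣n = ∈-primeDivisors⁺ q-prime (∣n⇒∣m*n p q∣n)

  möbius-nonSquareFree : ∀ n → squareFree n ≡ false → möbius n ≡ + 0
  möbius-nonSquareFree n eq rewrite eq = refl

  möbius-squareFree : ∀ n → squareFree n ≡ true → möbius n ≡ (ℤ.- + 1) ℤ.^ numPrimeDivisors n
  möbius-squareFree n eq rewrite eq = refl

  möbius-*-prime-∣ : ∀ {p n} .{{_ : NonZero n}} → Prime p → p ∣ n → möbius (p * n) ≡ + 0
  möbius-*-prime-∣ {p} {n} p-prime p∣n =
    möbius-nonSquareFree (p * n) (squareFree≡false⁺ p-prime (*-monoʳ-∣ p p∣n))
    where instance _ = ℕ.m*n≢0 p n {{prime⇒nonZero p-prime}}

  möbius-*-prime-∤ : ∀ {p n} .{{_ : NonZero n}} → Prime p → ¬ p ∣ n → möbius (p * n) ≡ ℤ.- möbius n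
  möbius-*-prime-∤ {p} {n} p-prime p∤n with squareFree n Bool.≟ true
  ... | no ¬sf with squareFree≡false⁻ (¬-not ¬sf)
  ...   | q , q-prime , qq∣n = begin
    möbius (p * n) ≡⟨ möbius-nonSquareFree (p * n) (squareFree≡false⁺ q-prime (∣n⇒∣m*n p qq∣n)) ⟩
    + 0            ≡⟨ cong ℤ.-_ (möbius-nonSquareFree n (¬-not ¬sf)) ⟨
    ℤ.- möbius n   ∎
    where instance _ = ℕ.m*n≢0 p n {{prime⇒nonZero p-prime}}
  möbius-*-prime-∤ {p} {n} p-prime p∤n | yes sf = begin
    möbius (p * n)                                   ≡⟨ möbius-squareFree (p * n) (squareFree-*-prime p-prime p∤n sf) ⟩
    (ℤ.- + 1) ℤ.^ numPrimeDivisors (p * n)           ≡⟨ cong ((ℤ.- + 1) ℤ.^_) (↭-length (primeDivisors-*-prime p-prime p∤n)) ⟩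
    (ℤ.- + 1) ℤ.* (ℤ.- + 1) ℤ.^ numPrimeDivisors n  ≡⟨ -1*i≡-i _ ⟩
    ℤ.- ((ℤ.- + 1) ℤ.^ numPrimeDivisors n)          ≡⟨ cong ℤ.-_ (möbius-squareFree n sf) ⟨
    ℤ.- möbius n                                     ∎

module MöbiusInversion where
  open import Data.Nat as ℕ using (ℕ; suc; NonZero; _≟_; s≤s; z≤n)
  import Data.Nat.Properties as ℕ
  open import Data.Nat.Divisibility using (_∣?_; divides-refl; ∣-trans; ∣-reflexive; m∣n⇒n≡m*quotient; quotient≢0)
  open import Data.Nat.Primality using (Prime; prime⇒nonZero)
  open import Data.Integer using (+_)
  open import Data.Rational using (ℚ; 0ℚ; 1ℚ; _+_; _*_; -_; _/_)
  open import Data.Rational.Properties using (+-identityˡ; +-inverseˡ; *-zeroˡ; *-zeroʳ; *-identityˡ; *-comm; *-assoc)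
  open import Data.List.Properties using (map-∘; map-cong; map-cong-local)
  open import Data.List.Membership.Propositional.Properties using (∈-filter⁻)
  import Data.List.Relation.Unary.All as All
  open import Data.List.Relation.Unary.All.Properties using (all-filter)
  import Data.List.Relation.Binary.Permutation.Propositional.Properties as ↭
  open import Data.Bool using (if_then_else_)
  open RationalEmbedding
  open FiniteSums
  open Divisors
  open MöbiusFunction using (prime-factor; möbius-*-prime-∣; möbius-*-prime-∤)
  open Conditionals

  μℚ : ℕ → ℚ
  μℚ = ℤ→ℚ ∘ möbius

  Σμ-divisors-p*n≡0 : ∀ {p n} .{{_ : NonZero n}} → Prime p → Σℚ (map μℚ (divisors (p ℕ.* n))) ≡ 0ℚ
  Σμ-divisors-p*n≡0 {p} {n} p-prime = begin
    Σℚ (map μℚ (divisors (p ℕ.* n)))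
      ≡⟨ Σℚ-partition (p ∣?_) μℚ (divisors (p ℕ.* n)) ⟩
    Σℚ (map μℚ (filter (p ∣?_) (divisors (p ℕ.* n)))) + Σℚ (map μℚ (filter p∤? (divisors (p ℕ.* n))))
      ≡⟨ cong₂ _+_ (Σℚ-↭ (↭.map⁺ μℚ (∣-divisors-* p n))) (Σℚ-↭ (↭.map⁺ μℚ (∤-divisors-* p-prime n))) ⟩
    Σℚ (map μℚ (map (p ℕ.*_) (divisors n))) + S
      ≡⟨ cong (λ s → Σℚ s + S) (map-∘ (divisors n)) ⟨
    Σℚ (map (μℚ ∘ (p ℕ.*_)) (divisors n)) + S
      ≡⟨ cong (_+ S) (Σℚ-partition (p ∣?_) (μℚ ∘ (p ℕ.*_)) (divisors n)) ⟩
    Σℚ (map (μℚ ∘ (p ℕ.*_)) (filter (p ∣?_) (divisors n))) + Σℚ (map (μℚ ∘ (p ℕ.*_)) (filter p∤? (divisors n))) + S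
      ≡⟨ cong (_+ S) (cong₂ _+_ (Σℚ-zero _ μ[p*e]≡0) (cong Σℚ (map-cong-local (All.tabulate μ[p*e]≡-μe)))) ⟩
    0ℚ + Σℚ (map (λ e → - μℚ e) (filter p∤? (divisors n))) + S
      ≡⟨ cong (_+ S) (trans (+-identityˡ _) (sym (Σℚ-neg μℚ (filter p∤? (divisors n))))) ⟩
    - S + S
      ≡⟨ +-inverseˡ S ⟩
    0ℚ ∎
    where
    instance _ = prime⇒nonZero p-prime
    p∤? = ¬? ∘ (p ∣?_)
    S = Σℚ (map μℚ (filter p∤? (divisors n)))
    μ[p*e]≡0 : ∀ {e} → e ∈ filter (p ∣?_) (divisors n) → μℚ (p ℕ.* e) ≡ 0ℚ
    μ[p*e]≡0 e∈ with ∈-filter⁻ (p ∣?_) {xs = divisors n} e∈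
    ... | e∈′ , p∣e = cong ℤ→ℚ (möbius-*-prime-∣ {{∣⇒nonZero (∈-divisors⁻ e∈′)}} p-prime p∣e)
    μ[p*e]≡-μe : ∀ {e} → e ∈ filter p∤? (divisors n) → μℚ (p ℕ.* e) ≡ - μℚ e
    μ[p*e]≡-μe {e} e∈ with ∈-filter⁻ p∤? {xs = divisors n} e∈
    ... | e∈′ , p∤e =
      trans (cong ℤ→ℚ (möbius-*-prime-∤ {{∣⇒nonZero (∈-divisors⁻ e∈′)}} p-prime p∤e)) (ℤ→ℚ-neg (möbius e))

  Σμ-divisors≡0 : ∀ n → Σℚ (map μℚ (divisors (suc (suc n)))) ≡ 0ℚ
  Σμ-divisors≡0 n with prime-factor n
  ... | p , p-prime , p∣n = subst (λ m → Σℚ (map μℚ (divisors m)) ≡ 0ℚ) (sym (m∣n⇒n≡m*quotient p∣n))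
                                  (Σμ-divisors-p*n≡0 {{quotient≢0 p∣n}} p-prime)

  Σμ÷-∣-divisors-* : ∀ m n .{{_ : NonZero m}} .{{_ : NonZero n}} c →
    Σℚ (map (λ d → μℚ ((m ℕ.* n) ÷ d) * c) (filter (m ∣?_) (divisors (m ℕ.* n)))) ≡ Σℚ (map μℚ (divisors n)) * c
  Σμ÷-∣-divisors-* m n c = begin
    Σℚ (map F (filter (m ∣?_) (divisors (m ℕ.* n))))  ≡⟨ Σℚ-↭ (↭.map⁺ F (∣-divisors-* m n)) ⟩
    Σℚ (map F (map (m ℕ.*_) (divisors n)))            ≡⟨ cong Σℚ (map-∘ (divisors n)) ⟨
    Σℚ (map (F ∘ (m ℕ.*_)) (divisors n))              ≡⟨ cong Σℚ (map-cong-local (All.tabulate cancel-m)) ⟩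
    Σℚ (map (λ e → μℚ (n ÷ e) * c) (divisors n))      ≡⟨ Σℚ-*ʳ c (μℚ ∘ (n ÷_)) (divisors n) ⟨
    Σℚ (map (μℚ ∘ (n ÷_)) (divisors n)) * c           ≡⟨ cong (λ s → Σℚ s * c) (map-∘ (divisors n)) ⟩
    Σℚ (map μℚ (map (n ÷_) (divisors n))) * c         ≡⟨ cong (_* c) (Σℚ-↭ (↭.map⁺ μℚ (divisors-complement n))) ⟩
    Σℚ (map μℚ (divisors n)) * c                      ∎
    where
    F = λ d → μℚ ((m ℕ.* n) ÷ d) * c
    cancel-m : ∀ {e} → e ∈ divisors n → F (m ℕ.* e) ≡ μℚ (n ÷ e) * c
    cancel-m {e} e∈ = cong (λ x → μℚ x * c) (*-÷-* m n e)
      where instance _ = ∣⇒nonZero (∈-divisors⁻ e∈)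

  Σμ÷-∣-divisors-of-multiple : ∀ m n .{{_ : NonZero m}} .{{_ : NonZero n}} c →
    Σℚ (map (λ d → μℚ ((m ℕ.* n) ÷ d) * c) (filter (m ∣?_) (divisors (m ℕ.* n)))) ≡
    (if ⌊ m ≟ m ℕ.* n ⌋ then c else 0ℚ)
  Σμ÷-∣-divisors-of-multiple m 1 c = begin
    _       ≡⟨ Σμ÷-∣-divisors-* m 1 c ⟩
    1ℚ * c  ≡⟨ *-identityˡ c ⟩
    c       ≡⟨ if-yes (m ≟ m ℕ.* 1) (sym (ℕ.*-identityʳ m)) ⟨
    _       ∎
  Σμ÷-∣-divisors-of-multiple m n@(suc (suc r)) c = begin
    _                             ≡⟨ Σμ÷-∣-divisors-* m n c ⟩
    Σℚ (map μℚ (divisors n)) * c  ≡⟨ cong (_* c) (Σμ-divisors≡0 r) ⟩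
    0ℚ * c                        ≡⟨ *-zeroˡ c ⟩
    0ℚ                            ≡⟨ if-no (m ≟ m ℕ.* n) (ℕ.<⇒≢ (ℕ.m<m*n m n (s≤s (s≤s z≤n)))) ⟨
    _                             ∎

  Σμ÷-∣-divisors : ∀ m i .{{_ : NonZero i}} c →
    Σℚ (map (λ d → μℚ (i ÷ d) * c) (filter (m ∣?_) (divisors i))) ≡ (if ⌊ m ≟ i ⌋ then c else 0ℚ)
  Σμ÷-∣-divisors m i c with m ∣? i
  ... | no m∤i = trans (Σℚ-zero _ m∣d⇒⊥) (sym (if-no (m ≟ i) (m∤i ∘ ∣-reflexive)))
    where
    m∣d⇒⊥ : ∀ {d} → d ∈ filter (m ∣?_) (divisors i) → μℚ (i ÷ d) * c ≡ 0ℚ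
    m∣d⇒⊥ d∈ with ∈-filter⁻ (m ∣?_) {xs = divisors i} d∈
    ... | d∈′ , m∣d = contradiction (∣-trans m∣d (∈-divisors⁻ d∈′)) m∤i
  ... | yes (divides-refl q) =
    subst (λ j → Σℚ (map (λ d → μℚ (j ÷ d) * c) (filter (m ∣?_) (divisors j))) ≡ (if ⌊ m ≟ j ⌋ then c else 0ℚ))
      (ℕ.*-comm m q) (Σμ÷-∣-divisors-of-multiple m q {{ℕ.m*n≢0⇒n≢0 q}} {{ℕ.m*n≢0⇒m≢0 q}} c)

  möbius-inversion-∣ : ∀ m i .{{_ : NonZero i}} c →
    Σℚ (map (λ d → μℚ (i ÷ d) * (if ⌊ m ∣? d ⌋ then c else 0ℚ)) (divisors i)) ≡ (if ⌊ m ≟ i ⌋ then c else 0ℚ)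
  möbius-inversion-∣ m i c = begin
    _ ≡⟨ cong Σℚ (map-cong (λ d → *-if (μℚ (i ÷ d)) (m ∣? d)) (divisors i)) ⟩
    _ ≡⟨ Σℚ-if (m ∣?_) (λ d → μℚ (i ÷ d) * c) (divisors i) ⟩
    _ ≡⟨ Σμ÷-∣-divisors m i c ⟩
    _ ∎
    where
    *-if : ∀ x {P : Set} (P? : Dec P) → x * (if ⌊ P? ⌋ then c else 0ℚ) ≡ (if ⌊ P? ⌋ then x * c else 0ℚ)
    *-if x (yes _) = refl
    *-if x (no _)  = *-zeroʳ x

  Σμ÷Ξ-divisors : ∀ μ i .{{_ : NonZero i}} →
                  Σℚ (map (λ d → μℚ (i ÷ d) * Ξ μ d) (divisors i)) ≡ ℕ→ℚ (mult i μ) * ℕ→ℚ i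
  Σμ÷Ξ-divisors μ i = begin
    Σℚ (map (λ d → μℚ (i ÷ d) * Ξ μ d) (divisors i))
      ≡⟨ cong Σℚ (map-cong (λ d → Σℚ-*ˡ (μℚ (i ÷ d)) (ξ d) μ) (divisors i)) ⟩
    Σℚ (map (λ d → Σℚ (map (λ m → μℚ (i ÷ d) * ξ d m) μ)) (divisors i))
      ≡⟨ Σℚ-swap (λ d m → μℚ (i ÷ d) * ξ d m) (divisors i) μ ⟩
    Σℚ (map (λ m → Σℚ (map (λ d → μℚ (i ÷ d) * ξ d m) (divisors i))) μ)
      ≡⟨ cong Σℚ (map-cong (λ m → möbius-inversion-∣ m i (ℕ→ℚ m)) μ) ⟩
    Σℚ (map (λ m → if ⌊ m ≟ i ⌋ then ℕ→ℚ m else 0ℚ) μ)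
      ≡⟨ Σℚ-if (_≟ i) ℕ→ℚ μ ⟩
    Σℚ (map ℕ→ℚ (filter (_≟ i) μ))
      ≡⟨ Σℚ-const (filter (_≟ i) μ) (All.map (cong ℕ→ℚ) (all-filter (_≟ i) μ)) ⟩
    ℕ→ℚ (mult i μ) * ℕ→ℚ i ∎
    where
    ξ : ℕ → ℕ → ℚ
    ξ d m = if ⌊ m ∣? d ⌋ then ℕ→ℚ m else 0ℚ

  qbar-Ξ : ∀ μ k → qbar (Ξ μ) k ≡ ℕ→ℚ (mult (suc k) μ)
  qbar-Ξ μ k = begin
    (+ 1 / i) * Σℚ (map (λ d → if ⌊ suc d ∣? i ⌋ then G (suc d) else 0ℚ) (upTo i))
      ≡⟨ cong (λ s → (+ 1 / i) * Σℚ s) (map-∘ {g = λ d → if ⌊ d ∣? i ⌋ then G d else 0ℚ} {f = suc} (upTo i)) ⟩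
    (+ 1 / i) * Σℚ (map (λ d → if ⌊ d ∣? i ⌋ then G d else 0ℚ) (oneTo i))
      ≡⟨ cong ((+ 1 / i) *_) (trans (Σℚ-if (_∣? i) G (oneTo i)) (Σμ÷Ξ-divisors μ i)) ⟩
    (+ 1 / i) * (M * ℕ→ℚ i)
      ≡⟨ cong ((+ 1 / i) *_) (*-comm M (ℕ→ℚ i)) ⟩
    (+ 1 / i) * (ℕ→ℚ i * M)
      ≡⟨ *-assoc (+ 1 / i) (ℕ→ℚ i) M ⟨
    (+ 1 / i) * ℕ→ℚ i * M
      ≡⟨ cong (_* M) (1/n*n≡1 i) ⟩
    1ℚ * M
      ≡⟨ *-identityˡ M ⟩
    M ∎
    where
    i = suc k
    M = ℕ→ℚ (mult i μ)
    G : ℕ → ℚ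
    G d = μℚ (i ÷ d) * Ξ μ d

module FallingFactorial where
  open import Data.Nat as ℕ using (zero; suc; _<_; _!; s≤s)
  import Data.Nat.Properties as ℕ
  open import Data.Rational using (0ℚ; 1ℚ; _+_; _*_; _-_)
  open import Data.Rational.Properties using (+-inverseʳ; *-zeroˡ; *-zeroʳ)
  open import Data.Rational.Solver using (module +-*-Solver)
  open +-*-Solver
  open RationalEmbedding using (ℕ→ℚ-suc; ℕ→ℚ-*)

  falling-< : ∀ {m r} → m < r → falling (ℕ→ℚ m) r ≡ 0ℚ
  falling-< {m} {suc r} (s≤s m≤r) with m ℕ.≟ r
  ... | yes refl = trans (cong (falling (ℕ→ℚ m) m *_) (+-inverseʳ (ℕ→ℚ m))) (*-zeroʳ (falling (ℕ→ℚ m) m))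
  ... | no m≢r   =
    trans (cong (_* (ℕ→ℚ m - ℕ→ℚ r)) (falling-< (ℕ.≤∧≢⇒< m≤r m≢r))) (*-zeroˡ (ℕ→ℚ m - ℕ→ℚ r))

  falling-suc : ∀ x r → falling (1ℚ + x) (suc r) ≡ (1ℚ + x) * falling x r
  falling-suc x zero    = solve 1 (λ x → con 1ℚ :* ((con 1ℚ :+ x) :- con 0ℚ) := (con 1ℚ :+ x) :* con 1ℚ) refl x
  falling-suc x (suc r) = begin
    falling (1ℚ + x) (suc r) * ((1ℚ + x) - ℕ→ℚ (suc r))
      ≡⟨ cong₂ (λ f y → f * ((1ℚ + x) - y)) (falling-suc x r) (ℕ→ℚ-suc r) ⟩
    (1ℚ + x) * falling x r * ((1ℚ + x) - (1ℚ + ℕ→ℚ r))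
      ≡⟨ solve 3 (λ x f n → (con 1ℚ :+ x) :* f :* ((con 1ℚ :+ x) :- (con 1ℚ :+ n)) := (con 1ℚ :+ x) :* (f :* (x :- n)))
               refl x (falling x r) (ℕ→ℚ r) ⟩
    (1ℚ + x) * (falling x r * (x - ℕ→ℚ r)) ∎

  falling-self : ∀ r → falling (ℕ→ℚ r) r ≡ ℕ→ℚ (r !)
  falling-self zero    = refl
  falling-self (suc r) = begin
    falling (ℕ→ℚ (suc r)) (suc r)     ≡⟨ cong (λ x → falling x (suc r)) (ℕ→ℚ-suc r) ⟩
    falling (1ℚ + ℕ→ℚ r) (suc r)      ≡⟨ falling-suc (ℕ→ℚ r) r ⟩
    (1ℚ + ℕ→ℚ r) * falling (ℕ→ℚ r) r  ≡⟨ cong₂ _*_ (sym (ℕ→ℚ-suc r)) (falling-self r) ⟩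
    ℕ→ℚ (suc r) * ℕ→ℚ (r !)           ≡⟨ ℕ→ℚ-* (suc r) (r !) ⟨
    ℕ→ℚ (suc r !)                     ∎

module Multiplicities where
  open import Data.Nat using (ℕ; suc; _+_; _≤_; z≤n; s≤s; _≟_; _≤?_)
  import Data.Nat.Properties as ℕ
  open import Data.Nat.ListAction.Properties using (sum-↭)
  open import Data.List using (_++_)
  open import Data.List.Properties using (filter-accept; filter-reject)
  open import Data.List.Membership.Propositional using (_∉_)
  open import Data.List.Membership.DecPropositional _≟_ using (_∈?_)
  open import Data.List.Membership.Propositional.Properties using (∈-∃++; ∈-upTo⁺)
  import Data.List.Relation.Unary.All as All
  open import Data.List.Relation.Unary.All using (all?)
  open import Data.List.Relation.Binary.Permutation.Propositional
    using (↭-refl; ↭-prep; ↭-trans; ↭-sym; ↭⇒↭ₛ; ↭ₛ⇒↭)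
  open import Data.List.Relation.Binary.Permutation.Propositional.Properties using (↭-length; shift; All-resp-↭)
  import Data.List.Relation.Binary.Permutation.Setoid.Properties as ↭ₛ
  open import Data.List.Relation.Unary.Sorted.TotalOrder.Properties using (↗↭↗⇒≋)
  open import Data.List.Relation.Binary.Pointwise using (Pointwise-≡⇒≡)
  open import Relation.Binary.PropositionalEquality using (setoid)
  open import Relation.Binary.Properties.TotalOrder ℕ.≤-totalOrder using (≥-totalOrder)

  mult-here : ∀ x l → mult x (x ∷ l) ≡ suc (mult x l)
  mult-here x l = cong length (filter-accept (_≟ x) refl)

  mult-there : ∀ {i x} l → x ≢ i → mult i (x ∷ l) ≡ mult i l
  mult-there l x≢i = cong length (filter-reject (_≟ _) x≢i)

  mult-∉ : ∀ {i} l → i ∉ l → mult i l ≡ 0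
  mult-∉     []      _  = refl
  mult-∉ {i} (x ∷ l) i∉ = trans (mult-there {i} {x} l λ { refl → i∉ (here refl) }) (mult-∉ l (i∉ ∘ there))

  mult-↭ : ∀ i {l l′} → l ↭ l′ → mult i l ≡ mult i l′
  mult-↭ i l↭l′ = ↭-length (↭ₛ⇒↭ (↭ₛ.filter⁺ (setoid ℕ) (_≟ i) (λ { refl x≡i → x≡i }) (↭⇒↭ₛ l↭l′)))

  ∈⇒≤size : ∀ {x l} → x ∈ l → x ≤ size l
  ∈⇒≤size {l = y ∷ l} (here refl) = ℕ.m≤m+n y (size l)
  ∈⇒≤size {l = y ∷ l} (there x∈) = ℕ.≤-trans (∈⇒≤size x∈) (ℕ.m≤n+m (size l) y)

  -- Each part of γ is removed from μ in turn; the size bound leaves nothing of μ over.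
  ↭-of-mult-≤ : ∀ γ μ → All (1 ≤_) μ → (∀ i → mult i γ ≤ mult i μ) → size μ ≤ size γ → γ ↭ μ
  ↭-of-mult-≤ []      []      _          _   _  = ↭-refl
  ↭-of-mult-≤ []      (y ∷ μ) (1≤y ∷ _)  _   le =
    contradiction (ℕ.≤-trans 1≤y (ℕ.≤-trans (ℕ.m≤m+n y (size μ)) le)) λ ()
  ↭-of-mult-≤ (x ∷ γ) μ       μ⁺         dom le with x ∈? μ
  ... | no x∉μ =
    contradiction (subst₂ _≤_ (mult-here x γ) (mult-∉ μ x∉μ) (dom x)) λ ()
  ... | yes x∈μ with ∈-∃++ x∈μ
  ...   | as , bs , refl = ↭-trans (↭-prep x (↭-of-mult-≤ γ μ′ μ′⁺ dom′ le′)) (↭-sym μ↭x∷μ′)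
    where
    μ′ = as ++ bs
    μ↭x∷μ′ : as ++ x ∷ bs ↭ x ∷ μ′
    μ↭x∷μ′ = shift x as bs
    μ′⁺ : All (1 ≤_) μ′
    μ′⁺ = All.tail (All-resp-↭ μ↭x∷μ′ μ⁺)
    dom′ : ∀ i → mult i γ ≤ mult i μ′
    dom′ i with x ≟ i
    ... | yes refl = ℕ.≤-pred (subst₂ _≤_ (mult-here x γ) (trans (mult-↭ x μ↭x∷μ′) (mult-here x μ′)) (dom x))
    ... | no x≢i   = subst₂ _≤_ (mult-there γ x≢i) (trans (mult-↭ i μ↭x∷μ′) (mult-there μ′ x≢i)) (dom i)
    le′ : size μ′ ≤ size γ
    le′ = ℕ.+-cancelˡ-≤ x _ _ (subst (_≤ x + size γ) (sum-↭ μ↭x∷μ′) le)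

  Dominated : List ℕ → List ℕ → Set
  Dominated γ μ = All (λ k → mult (suc k) γ ≤ mult (suc k) μ) (upTo (size γ))

  Dominated? : ∀ γ μ → Dec (Dominated γ μ)
  Dominated? γ μ = all? (λ k → mult (suc k) γ ≤? mult (suc k) μ) (upTo (size γ))

  Dominated-refl : ∀ γ → Dominated γ γ
  Dominated-refl γ = All.tabulate (λ _ → ℕ.≤-refl)

  Dominated⇒mult-≤ : ∀ γ μ → All (1 ≤_) γ → Dominated γ μ → ∀ i → mult i γ ≤ mult i μ
  Dominated⇒mult-≤ γ μ γ⁺ dom i with i ∈? γ
  ... | no i∉γ = subst (_≤ mult i μ) (sym (mult-∉ γ i∉γ)) z≤n
  ... | yes i∈γ with All.lookup γ⁺ i∈γ
  ...   | s≤s z≤n = All.lookup dom (∈-upTo⁺ (∈⇒≤size i∈γ))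

  partition-↭⇒≡ : ∀ {γ μ} → IsPartition γ → IsPartition μ → γ ↭ μ → γ ≡ μ
  partition-↭⇒≡ (_ , γ↘) (_ , μ↘) γ↭μ = Pointwise-≡⇒≡ (↗↭↗⇒≋ ≥-totalOrder γ↘ μ↘ (↭⇒↭ₛ γ↭μ))

  Dominated⇒≡ : ∀ {γ μ} → IsPartition γ → IsPartition μ → Dominated γ μ → size μ ≤ size γ → γ ≡ μ
  Dominated⇒≡ {γ} {μ} γ-part μ-part dom le = partition-↭⇒≡ γ-part μ-part
    (↭-of-mult-≤ γ μ (proj₁ μ-part) (Dominated⇒mult-≤ γ μ (proj₁ γ-part) dom) le)

open import Data.Nat using (_<_)
open import Data.List using (List)
open import Data.Nat using (ℕ)
open import Data.Product using (_×_)
open import Data.Rational using (0ℚ; _*_)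
open import Relation.Binary.PropositionalEquality using (_≡_)

open import Data.Nat as ℕ using (suc; _^_; _!)
import Data.Nat.Properties as ℕ
open import Data.Rational using (1ℚ)
open import Data.Rational.Properties using (*-zeroʳ; *-identityʳ)
open import Data.List.Properties using (map-cong; map-∘; ≡-dec)
open import Data.List.Relation.Unary.All.Properties using (¬All⇒Any¬)
import Data.List.Relation.Unary.Any as Any
open Conditionals
open RationalEmbedding using (ℕ→ℚ-*)
open FiniteSums using (Πℚ-zero)
open MöbiusInversion using (qbar-Ξ)
open FallingFactorial
open Multiplicities

pbarPow-Ξ : ∀ μ k r → pbarPow (Ξ μ) k r ≡ ℕ→ℚ (suc k ^ r) * falling (ℕ→ℚ (mult (suc k) μ)) r
pbarPow-Ξ μ k r = cong (λ q → ℕ→ℚ (suc k ^ r) * falling q r) (qbar-Ξ μ k)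

pbar-Ξ-≡0 : ∀ γ μ → ¬ Dominated γ μ → pbar γ (Ξ μ) ≡ 0ℚ
pbar-Ξ-≡0 γ μ ¬dom = Πℚ-zero _ (upTo (size γ))
  (Any.map factor≡0 (¬All⇒Any¬ (λ k → mult (suc k) γ ℕ.≤? mult (suc k) μ) (upTo (size γ)) ¬dom))
  where
  factor≡0 : ∀ {k} → ¬ mult (suc k) γ ℕ.≤ mult (suc k) μ → pbarPow (Ξ μ) k (mult (suc k) γ) ≡ 0ℚ
  factor≡0 {k} excess = trans (pbarPow-Ξ μ k (mult (suc k) γ))
    (trans (cong (ℕ→ℚ (suc k ^ mult (suc k) γ) *_) (falling-< (ℕ.≰⇒> excess)))
           (*-zeroʳ (ℕ→ℚ (suc k ^ mult (suc k) γ))))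

pbar-Ξ-self : ∀ γ → pbar γ (Ξ γ) ≡ z γ
pbar-Ξ-self γ = trans (cong Πℚ (map-cong factor (upTo (size γ)))) (cong Πℚ (map-∘ (upTo (size γ))))
  where
  factor : ∀ k → pbarPow (Ξ γ) k (mult (suc k) γ) ≡ ℕ→ℚ (suc k ^ mult (suc k) γ ℕ.* mult (suc k) γ !)
  factor k = trans (pbarPow-Ξ γ k (mult (suc k) γ)) (trans
    (cong (ℕ→ℚ (suc k ^ mult (suc k) γ) *_) (falling-self (mult (suc k) γ)))
    (sym (ℕ→ℚ-* (suc k ^ mult (suc k) γ) (mult (suc k) γ !))))

lemma14 : (γ μ : List ℕ) → IsPartition γ → IsPartition μ →
  ((size μ < size γ → pbar γ (Ξ μ) ≡ 0ℚ) ×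
   (size μ ≡ size γ → pbar γ (Ξ μ) ≡ z γ * δ γ μ))
lemma14 γ μ γ-part μ-part = smaller (Dominated? γ μ) , same-size (Dominated? γ μ)
  where
  smaller : Dec (Dominated γ μ) → size μ < size γ → pbar γ (Ξ μ) ≡ 0ℚ
  smaller (yes dom) μ<γ = contradiction (cong size (Dominated⇒≡ γ-part μ-part dom (ℕ.<⇒≤ μ<γ))) (ℕ.>⇒≢ μ<γ)
  smaller (no ¬dom) _   = pbar-Ξ-≡0 γ μ ¬dom
  self : pbar γ (Ξ γ) ≡ z γ * δ γ γ
  self = begin
    pbar γ (Ξ γ)  ≡⟨ pbar-Ξ-self γ ⟩
    z γ           ≡⟨ *-identityʳ (z γ) ⟨
    z γ * 1ℚ      ≡⟨ cong (z γ *_) (if-yes (≡-dec ℕ._≟_ γ γ) {1ℚ} {0ℚ} refl) ⟨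
    z γ * δ γ γ   ∎
  same-size : Dec (Dominated γ μ) → size μ ≡ size γ → pbar γ (Ξ μ) ≡ z γ * δ γ μ
  same-size (yes dom) μ≡γ =
    subst (λ ν → pbar γ (Ξ ν) ≡ z γ * δ γ ν) (Dominated⇒≡ γ-part μ-part dom (ℕ.≤-reflexive μ≡γ)) self
  same-size (no ¬dom) _ = begin
    pbar γ (Ξ μ)  ≡⟨ pbar-Ξ-≡0 γ μ ¬dom ⟩
    0ℚ            ≡⟨ *-zeroʳ (z γ) ⟨
    z γ * 0ℚ      ≡⟨ cong (z γ *_) (if-no (≡-dec ℕ._≟_ γ μ) {1ℚ} {0ℚ} λ { refl → ¬dom (Dominated-refl γ) }) ⟨
    z γ * δ γ μ   ∎
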